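{- Every digraph $F$ is $\vec{\chi}$-maderian. More precisely, $\mathrm{mad}_{\vec{\chi}}(F)\le 4^{m}(n-1)+1$, where $m=|A(F)|$ and $n=|V(F)|$.
   Context: Digraphs are finite, without loops or parallel arcs. The dichromatic number $\vec{\chi}(D)$ is the least $k$ such that $V(D)$ can be partitioned into $k$ sets each inducing an acyclic subdigraph. A subdivision of $F$ is obtained by replacing each arc $(u,v)$ by a directed $(u,v)$-path of length at least 1, internally disjoint; $D$ contains a subdivision of $F$ if some subdigraph of $D$ is one. $F$ is $\vec{\chi}$-maderian if there is an integer $c$ such that every digraph $D$ with $\vec{\chi}(D)\ge c$ contains a subdivision of $F$; the least such $c$ is $\mathrm{mad}_{\vec{\chi}}(F)$. -}

module Defs where

open import Data.Nat using (ℕ; zero; suc; _+_; _*_; _∸_; _^_; _<_)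
open import Data.Fin using (Fin; zero; suc; toℕ; inject₁; fromℕ)
open import Data.Bool using (Bool; true; false; T; if_then_else_)
open import Data.Product using (Σ; ∃; _×_; _,_)
open import Relation.Nullary using (¬_)
open import Relation.Binary.PropositionalEquality using (_≡_)
open import Function.Definitions using (Injective)

-- A finite digraph on vertex set Fin n: an adjacency relation without loops.
-- (A relation automatically excludes parallel arcs; opposite arcs u→v, v→u are allowed.)
record Digraph (n : ℕ) : Set where
  field
    adj      : Fin n → Fin n → Bool
    loopless : ∀ v → adj v v ≡ false

open Digraph public

Arc : ∀ {n} → Digraph n → Fin n → Fin n → Set
Arc D u v = T (adj D u v)

sumFin : (n : ℕ) → (Fin n → ℕ) → ℕ
sumFin zero    f = 0
sumFin (suc n) f = f zero + sumFin n (λ i → f (suc i))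

arcCount : ∀ {n} → Digraph n → ℕ
arcCount {n} D = sumFin n (λ u → sumFin n (λ v → if adj D u v then 1 else 0))

record CycleIn {n : ℕ} (D : Digraph n) (S : Fin n → Set) : Set where
  field
    k      : ℕ
    c      : Fin (suc k) → Fin n
    inj    : Injective _≡_ _≡_ c
    inS    : ∀ i → S (c i)
    step   : ∀ (i : Fin k) → Arc D (c (inject₁ i)) (c (suc i))
    close  : Arc D (c (fromℕ k)) (c zero)

InducesAcyclic : ∀ {n} → Digraph n → (Fin n → Set) → Set
InducesAcyclic D S = ¬ CycleIn D S

-- V(D) can be partitioned into k sets each inducing an acyclic subdigraph
-- (the colour classes of f; empty classes are harmless).
Dicolourable : ∀ {n} → Digraph n → ℕ → Set
Dicolourable {n} D k =
  Σ (Fin n → Fin k) λ f → ∀ (i : Fin k) → InducesAcyclic D (λ v → f v ≡ i)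

DichromaticAtLeast : ∀ {n} → Digraph n → ℕ → Set
DichromaticAtLeast D c = ∀ k → k < c → ¬ Dicolourable D k

record Path {n : ℕ} (D : Digraph n) (x y : Fin n) : Set where
  field
    ℓ     : ℕ
    p     : Fin (suc (suc ℓ)) → Fin n   -- length of the path is suc ℓ ≥ 1
    inj   : Injective _≡_ _≡_ p
    start : p zero ≡ x
    end   : p (fromℕ (suc ℓ)) ≡ y
    step  : ∀ (i : Fin (suc ℓ)) → Arc D (p (inject₁ i)) (p (suc i))

open Path public

Internal : ∀ {n} {D : Digraph n} {x y : Fin n} → Path D x y → Fin n → Set
Internal P w = ∃ λ (i : Fin (suc (suc (ℓ P)))) →
  (0 < toℕ i) × (toℕ i < suc (ℓ P)) × (p P i ≡ w)

record ContainsSubdivision {nD nF : ℕ} (D : Digraph nD) (F : Digraph nF) : Set where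
  field
    φ        : Fin nF → Fin nD
    φ-inj    : Injective _≡_ _≡_ φ
    path     : ∀ u v → Arc F u v → Path D (φ u) (φ v)
    avoid    : ∀ u v (a : Arc F u v) w → Internal (path u v a) w → ∀ x → ¬ (φ x ≡ w)
    disjoint : ∀ u v (a : Arc F u v) u' v' (a' : Arc F u' v') →
               ¬ ((u ≡ u') × (v ≡ v')) →
               ∀ w → Internal (path u v a) w → ¬ Internal (path u' v' a') w

-- Induct on the number of arcs of F, proving for every vertex set U that D[U] either contains a
-- subdivision of F or is 4^m (n-1)-dicolourable.  Without arcs, U either has n vertices or gives
-- each of its at most n-1 vertices its own colour.  Otherwise delete an arc ab and induct on |U|:
-- pick x in U and let R be its strong component in D[U]; no cycle meets both R and U - R, so a
-- colouring of U - R (by induction) and one of R combine.  Split R into the classes of vertices at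
-- distance i from x and j to x.  If some class contains a subdivision of F - ab, go from the image
-- of a back to x and on to the image of b through vertices strictly closer to x, hence outside
-- that class, to reinstate ab.  Otherwise colour R by the parities of i and j and the colour
-- within the class: along a monochromatic cycle i never increases and j never decreases, so both
-- are constant and the cycle lies in a single class.

module Submission where

open import Defs
open import Data.Bool using (Bool; true; false; T; not; _∧_; _∨_; if_then_else_)
  renaming (_≤_ to _≤ᵇ_)
import Data.Bool.Properties as Bool
open import Data.Empty using (⊥; ⊥-elim)
open import Data.Fin using (Fin; zero; suc; toℕ; inject₁; fromℕ; inject≤; combine; _≟_)
open import Data.Fin.Properties
  using (toℕ-fromℕ; inject≤-injective; combine-injectiveˡ; combine-injectiveʳ; any?)
open import Data.Nat
  using (ℕ; zero; suc; _+_; _*_; _∸_; _^_; _≤_; _<_; _≤′_; ≤′-refl; ≤′-step; z≤n; s≤s; _≡ᵇ_)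
open import Data.Nat.Induction using (<-wellFounded)
open import Data.Nat.Properties hiding (_≟_)
open import Data.Product using (Σ; ∃; _×_; _,_; proj₁; proj₂)
import Data.Product as Product
open import Data.Sum using (_⊎_; inj₁; inj₂)
import Data.Sum as Sum
open import Data.Unit using (⊤; tt)
open import Data.Vec.Functional using ([]; _∷_)
open import Function using (_∘_; flip; _on_)
open import Function.Bundles using (Equivalence)
open import Function.Definitions using (Injective)
open import Induction.WellFounded using (Acc; acc)
open import Relation.Binary.Construct.Closure.ReflexiveTransitive
  using (Star; ε; _◅_; _◅◅_; revApp; reverse)
import Relation.Binary.Construct.On as On
open import Relation.Binary.Definitions using (DecidableEquality)
import Relation.Binary.Properties.Poset as PosetProperties
open import Relation.Binary.PropositionalEquality
open import Relation.Binary.Structures using (IsPartialOrder)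
open import Relation.Nullary using (¬_; Dec; yes; no)
open import Relation.Nullary.Decidable
  using (⌊_⌋; toWitness; fromWitness; toSum; T?; _×-dec_; _⊎-dec_)

∃-or-∀ : ∀ {n} {A B : Fin n → Set} → (∀ i → A i ⊎ B i) → ∃ A ⊎ (∀ i → B i)
∃-or-∀ {zero} f = inj₂ λ ()
∃-or-∀ {suc n} {A} {B} f with f zero | ∃-or-∀ {A = A ∘ suc} {B ∘ suc} (f ∘ suc)
... | inj₁ a | _            = inj₁ (zero , a)
... | inj₂ _ | inj₁ (i , a) = inj₁ (suc i , a)
... | inj₂ b | inj₂ g       = inj₂ λ { zero → b ; (suc i) → g i }

sumFin-mono : ∀ n {f g : Fin n → ℕ} → (∀ i → f i ≤ g i) → sumFin n f ≤ sumFin n g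
sumFin-mono zero    f≤g = z≤n
sumFin-mono (suc n) f≤g = +-mono-≤ (f≤g zero) (sumFin-mono n (f≤g ∘ suc))

sumFin-mono-< : ∀ n {f g : Fin n → ℕ} → (∀ i → f i ≤ g i) →
                ∀ j → f j < g j → sumFin n f < sumFin n g
sumFin-mono-< (suc n) f≤g zero    fj<gj = +-mono-<-≤ fj<gj (sumFin-mono n (f≤g ∘ suc))
sumFin-mono-< (suc n) f≤g (suc j) fj<gj =
  +-mono-≤-< (f≤g zero) (sumFin-mono-< n (f≤g ∘ suc) j fj<gj)

sumFin-≤ : ∀ n {f : Fin n → ℕ} → (∀ i → f i ≤ 1) → sumFin n f ≤ n
sumFin-≤ zero    f≤1 = z≤n
sumFin-≤ (suc n) f≤1 = +-mono-≤ (f≤1 zero) (sumFin-≤ n (f≤1 ∘ suc))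

indicator : Bool → ℕ
indicator b = if b then 1 else 0

indicator-≤1 : ∀ b → indicator b ≤ 1
indicator-≤1 true  = ≤-refl
indicator-≤1 false = z≤n

indicator-mono : ∀ {a b} → (T a → T b) → indicator a ≤ indicator b
indicator-mono {false}         _   = z≤n
indicator-mono {true}  {true}  _   = ≤-refl
indicator-mono {true}  {false} a⇒b = ⊥-elim (a⇒b tt)

indicator-mono-< : ∀ {a b} → ¬ T a → T b → indicator a < indicator b
indicator-mono-< {false} {true} _  _ = s≤s z≤n
indicator-mono-< {true}         ¬a _ = ⊥-elim (¬a tt)

≤ᵇ-from-T : ∀ {a b} → (T a → T b) → a ≤ᵇ b
≤ᵇ-from-T {false}         _   = Bool.≤-minimum _
≤ᵇ-from-T {true}  {true}  _   = Bool.≤-refl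
≤ᵇ-from-T {true}  {false} a⇒b = ⊥-elim (a⇒b tt)

module _ {n : ℕ} where

  infix  4 _∈_ _∉_ _⊆_
  infixr 6 _∪_
  infixr 7 _∩_ _∖_

  _∈_ : Fin n → (Fin n → Bool) → Set
  v ∈ P = T (P v)

  _∉_ : Fin n → (Fin n → Bool) → Set
  v ∉ P = ¬ v ∈ P

  _⊆_ : (Fin n → Bool) → (Fin n → Bool) → Set
  P ⊆ Q = ∀ {v} → v ∈ P → v ∈ Q

  _∪_ _∩_ _∖_ : (Fin n → Bool) → (Fin n → Bool) → Fin n → Bool
  (P ∪ Q) v = P v ∨ Q v
  (P ∩ Q) v = P v ∧ Q v
  (P ∖ Q) v = P v ∧ not (Q v)

  level : (Fin n → Bool) → (Fin n → ℕ) → ℕ → Fin n → Bool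
  level P d i = P ∩ λ v → d v ≡ᵇ i

  count : (Fin n → Bool) → ℕ
  count P = sumFin n (indicator ∘ P)

  ∈-∪⁺ˡ : ∀ {P Q v} → v ∈ P → v ∈ P ∪ Q
  ∈-∪⁺ˡ v∈P = Equivalence.from Bool.T-∨ (inj₁ v∈P)

  ∈-∪⁺ʳ : ∀ {P Q v} → v ∈ Q → v ∈ P ∪ Q
  ∈-∪⁺ʳ v∈Q = Equivalence.from Bool.T-∨ (inj₂ v∈Q)

  ∈-∪⁻ : ∀ {P Q v} → v ∈ P ∪ Q → v ∈ P ⊎ v ∈ Q
  ∈-∪⁻ = Equivalence.to Bool.T-∨

  ∈-∩⁺ : ∀ {P Q v} → v ∈ P → v ∈ Q → v ∈ P ∩ Q
  ∈-∩⁺ v∈P v∈Q = Equivalence.from Bool.T-∧ (v∈P , v∈Q)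

  ∈-∩⁻ : ∀ {P Q v} → v ∈ P ∩ Q → v ∈ P × v ∈ Q
  ∈-∩⁻ = Equivalence.to Bool.T-∧

  ∈-∖⁺ : ∀ {P Q v} → v ∈ P → v ∉ Q → v ∈ P ∖ Q
  ∈-∖⁺ {Q = Q} {v} v∈P v∉Q with Q v
  ... | true  = ⊥-elim (v∉Q tt)
  ... | false = Equivalence.from Bool.T-∧ (v∈P , tt)

  ∈-∖⁻ : ∀ {P Q v} → v ∈ P ∖ Q → v ∈ P × v ∉ Q
  ∈-∖⁻ {Q = Q} {v} h with Q v
  ... | true  = ⊥-elim (proj₂ (Equivalence.to Bool.T-∧ h))
  ... | false = proj₁ (Equivalence.to Bool.T-∧ h) , λ ()

  ∈-level⁺ : ∀ {P d i v} → v ∈ P → d v ≡ i → v ∈ level P d i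
  ∈-level⁺ {P} {d} {i} {v} v∈P dv≡i =
    ∈-∩⁺ {P = P} {λ u → d u ≡ᵇ i} {v} v∈P (≡⇒≡ᵇ (d v) i dv≡i)

  ∈-level⁻ : ∀ {P d i v} → v ∈ level P d i → v ∈ P × d v ≡ i
  ∈-level⁻ {P} {d} {i} {v} h =
    Product.map₂ (≡ᵇ⇒≡ (d v) i) (∈-∩⁻ {P = P} {λ u → d u ≡ᵇ i} {v} h)

  witness-or-⊆ : ∀ P Q → (∃ λ v → v ∈ P × v ∉ Q) ⊎ P ⊆ Q
  witness-or-⊆ P Q = Sum.map₂ (λ P⇒Q {v} → P⇒Q v) (∃-or-∀ classify)
    where
      classify : ∀ v → (v ∈ P × v ∉ Q) ⊎ (v ∈ P → v ∈ Q)
      classify v with T? (Q v)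
      ... | yes v∈Q = inj₂ λ _ → v∈Q
      ... | no  v∉Q = Sum.map (_, v∉Q) (λ v∉P v∈P → ⊥-elim (v∉P v∈P)) (toSum (T? (P v)))

  count≤n : ∀ P → count P ≤ n
  count≤n P = sumFin-≤ n (indicator-≤1 ∘ P)

  count-mono : ∀ P Q → P ⊆ Q → count P ≤ count Q
  count-mono P Q P⊆Q = sumFin-mono n λ v → indicator-mono (P⊆Q {v})

  count-mono-< : ∀ P Q {v} → P ⊆ Q → v ∈ Q → v ∉ P → count P < count Q
  count-mono-< P Q {v} P⊆Q v∈Q v∉P =
    sumFin-mono-< n (λ u → indicator-mono (P⊆Q {u})) v (indicator-mono-< v∉P v∈Q)

  -- Each non-stationary step adds a vertex, and there are only n of them.
  chain-stabilises : (L : ℕ → Fin n → Bool) → (∀ t → L t ⊆ L (suc t)) →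
                     ∃ λ t → t ≤ n × L (suc t) ⊆ L t
  chain-stabilises L grows with growth (suc n)
    where
      growth : ∀ t → (∃ λ s → s < t × L (suc s) ⊆ L s) ⊎ t ≤ count (L t)
      growth zero = inj₂ z≤n
      growth (suc t) with growth t | witness-or-⊆ (L (suc t)) (L t)
      ... | inj₁ (s , s<t , stable) | _         = inj₁ (s , m<n⇒m<1+n s<t , stable)
      ... | inj₂ _                  | inj₂ stable = inj₁ (t , n<1+n t , stable)
      ... | inj₂ t≤∣Lt∣ | inj₁ (v , new , ¬old) =
        inj₂ (≤-trans (s≤s t≤∣Lt∣) (count-mono-< (L t) (L (suc t)) (grows t) new ¬old))
  ... | inj₁ (s , s<1+n , stable) = s , ≤-pred s<1+n , stable
  ... | inj₂ 1+n≤count = ⊥-elim (<-irrefl refl (≤-trans 1+n≤count (count≤n (L (suc n)))))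

∷-injective : ∀ {A : Set} {n} {f : Fin n → A} {x : A} →
              Injective _≡_ _≡_ f → (∀ i → f i ≢ x) → Injective _≡_ _≡_ (x ∷ f)
∷-injective f-inj x∉f {zero}  {zero}  _ = refl
∷-injective f-inj x∉f {zero}  {suc j} e = ⊥-elim (x∉f j (sym e))
∷-injective f-inj x∉f {suc i} {zero}  e = ⊥-elim (x∉f i e)
∷-injective f-inj x∉f {suc i} {suc j} e = cong suc (f-inj e)

module _ {A : Set} {_≲_ : A → A → Set} (po : IsPartialOrder _≡_ _≲_) where
  private module PO = IsPartialOrder po

  private
    first-≲ : ∀ {k} (g : Fin (suc k) → A) → (∀ i → g (inject₁ i) ≲ g (suc i)) →
              ∀ i → g zero ≲ g i
    first-≲         g step zero    = PO.refl
    first-≲ {suc k} g step (suc i) = PO.trans (step zero) (first-≲ (g ∘ suc) (step ∘ suc) i)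

    ≲-last : ∀ {k} (g : Fin (suc k) → A) → (∀ i → g (inject₁ i) ≲ g (suc i)) →
             ∀ i → g i ≲ g (fromℕ k)
    ≲-last {zero}  g step zero    = PO.refl
    ≲-last {suc k} g step zero    = PO.trans (step zero) (≲-last (g ∘ suc) (step ∘ suc) zero)
    ≲-last {suc k} g step (suc i) = ≲-last (g ∘ suc) (step ∘ suc) i

  around-cycle-constant : ∀ {k} (g : Fin (suc k) → A) →
    (∀ i → g (inject₁ i) ≲ g (suc i)) → g (fromℕ k) ≲ g zero → ∀ i → g i ≡ g zero
  around-cycle-constant g step close i =
    PO.antisym (PO.trans (≲-last g step i) close) (first-≲ g step i)

parity : ℕ → Fin 2
parity zero          = zero
parity (suc zero)    = suc zero
parity (suc (suc n)) = parity n

parity-suc : ∀ n → parity (suc n) ≢ parity n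
parity-suc zero          ()
parity-suc (suc zero)    ()
parity-suc (suc (suc n)) = parity-suc n

same-parity-≤ : ∀ {m n} → m ≤ suc n → parity m ≡ parity n → m ≤ n
same-parity-≤ {m} {n} m≤1+n same with m≤n⇒m<n∨m≡n m≤1+n
... | inj₁ m<1+n = ≤-pred m<1+n
... | inj₂ refl  = ⊥-elim (parity-suc n same)

-- Walks

module _ {V : Set} where

  infix 4 _∈ʷ_ _∉ʷ_ _⊆ʷ_

  _∈ʷ_ : ∀ {R : V → V → Set} {s t} → V → Star R s t → Set
  _∈ʷ_ {s = s} z ε       = z ≡ s
  _∈ʷ_ {s = s} z (_ ◅ w) = z ≡ s ⊎ z ∈ʷ w

  _∉ʷ_ : ∀ {R : V → V → Set} {s t} → V → Star R s t → Set
  z ∉ʷ w = ¬ z ∈ʷ w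

  _⊆ʷ_ : ∀ {R : V → V → Set} {s t s′ t′} → Star R s t → Star R s′ t′ → Set
  w ⊆ʷ w′ = ∀ {z} → z ∈ʷ w → z ∈ʷ w′

  ∈ʷ-start : ∀ {R : V → V → Set} {s t} (w : Star R s t) → s ∈ʷ w
  ∈ʷ-start ε       = refl
  ∈ʷ-start (_ ◅ _) = inj₁ refl

  module _ {R : V → V → Set} where

    ∈ʷ-end : ∀ {s t} (w : Star R s t) → t ∈ʷ w
    ∈ʷ-end ε       = refl
    ∈ʷ-end (_ ◅ w) = inj₂ (∈ʷ-end w)

    ∈ʷ-◅◅ : ∀ {s m t z} (w₁ : Star R s m) (w₂ : Star R m t) →
            z ∈ʷ w₁ ◅◅ w₂ → z ∈ʷ w₁ ⊎ z ∈ʷ w₂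
    ∈ʷ-◅◅ ε        w₂ z∈w₂          = inj₂ z∈w₂
    ∈ʷ-◅◅ (_ ◅ w₁) w₂ (inj₁ refl)   = inj₁ (inj₁ refl)
    ∈ʷ-◅◅ (_ ◅ w₁) w₂ (inj₂ z∈w₁w₂) = Sum.map₁ inj₂ (∈ʷ-◅◅ w₁ w₂ z∈w₁w₂)

    ∈ʷ-revApp : ∀ {s m t z} (w : Star (flip R) m s) (w′ : Star R m t) →
                z ∈ʷ revApp (λ e → e) w w′ → z ∈ʷ w ⊎ z ∈ʷ w′
    ∈ʷ-revApp ε       w′ z∈w′ = inj₂ z∈w′
    ∈ʷ-revApp (e ◅ w) w′ z∈   with ∈ʷ-revApp w (e ◅ w′) z∈
    ... | inj₁ z∈w         = inj₁ (inj₂ z∈w)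
    ... | inj₂ (inj₁ refl) = inj₁ (inj₂ (∈ʷ-start w))
    ... | inj₂ (inj₂ z∈w′) = inj₂ z∈w′

    ∈ʷ-reverse : ∀ {s t z} (w : Star (flip R) t s) → z ∈ʷ reverse (λ e → e) w → z ∈ʷ w
    ∈ʷ-reverse w z∈ with ∈ʷ-revApp w ε z∈
    ... | inj₁ z∈w  = z∈w
    ... | inj₂ refl = ∈ʷ-start w

    Simple : ∀ {s t} → Star R s t → Set
    Simple ε                 = ⊤
    Simple {s} (_ ◅ w) = s ∉ʷ w × Simple w

    dropUntil : ∀ {a b t} (w : Star R b t) → a ∈ʷ w →
                Σ (Star R a t) λ w′ → w′ ⊆ʷ w × (Simple w → Simple w′)
    dropUntil ε       refl        = ε , (λ z∈ → z∈) , (λ simple → simple)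
    dropUntil (e ◅ w) (inj₁ refl) = e ◅ w , (λ z∈ → z∈) , (λ simple → simple)
    dropUntil (e ◅ w) (inj₂ a∈w)  with dropUntil w a∈w
    ... | w′ , w′⊆w , simple = w′ , inj₂ ∘ w′⊆w , simple ∘ proj₂

    module _ (_≟ᵥ_ : DecidableEquality V) where

      _∈ʷ?_ : ∀ {s t} (z : V) (w : Star R s t) → Dec (z ∈ʷ w)
      _∈ʷ?_ {s} z ε       = z ≟ᵥ s
      _∈ʷ?_ {s} z (_ ◅ w) = (z ≟ᵥ s) ⊎-dec (z ∈ʷ? w)

      shortcut : ∀ {s t} (w : Star R s t) → Σ (Star R s t) λ w′ → Simple w′ × w′ ⊆ʷ w
      shortcut ε = ε , tt , (λ z∈ → z∈)
      shortcut {s} (e ◅ w) with shortcut w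
      ... | w′ , simple , w′⊆w with s ∈ʷ? w′
      ...   | no s∉w′  = e ◅ w′ , (s∉w′ , simple) , Sum.map₂ w′⊆w
      ...   | yes s∈w′ with dropUntil w′ s∈w′
      ...     | w″ , w″⊆w′ , simple′ = w″ , simple′ simple , inj₂ ∘ w′⊆w ∘ w″⊆w′

Arc-irreflexive : ∀ {n} (G : Digraph n) {v} → ¬ Arc G v v
Arc-irreflexive G {v} = subst T (loopless G v)

is-pair : ∀ {n} → Fin n → Fin n → Fin n → Fin n → Bool
is-pair a b u v = ⌊ u ≟ a ⌋ ∧ ⌊ v ≟ b ⌋

is-pair⁻ : ∀ {n} {a b u v : Fin n} → T (is-pair a b u v) → u ≡ a × v ≡ b
is-pair⁻ {a = a} {b} {u} {v} =
  Product.map toWitness toWitness ∘ Equivalence.to (Bool.T-∧ {⌊ u ≟ a ⌋} {⌊ v ≟ b ⌋})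

is-pair-refl : ∀ {n} {a b : Fin n} → T (is-pair a b a b)
is-pair-refl {a = a} {b} =
  Equivalence.from Bool.T-∧ (fromWitness {a? = a ≟ a} refl , fromWitness {a? = b ≟ b} refl)

deleteArc : ∀ {n} → Digraph n → Fin n → Fin n → Digraph n
deleteArc F a b = record
  { adj      = λ u → adj F u ∖ is-pair a b u
  ; loopless = λ v → cong (_∧ _) (loopless F v)
  }

module _ {n} (F : Digraph n) {a b : Fin n} where

  deleteArc-⊆ : ∀ u → adj (deleteArc F a b) u ⊆ adj F u
  deleteArc-⊆ u {v} = proj₁ ∘ ∈-∖⁻ {P = adj F u} {is-pair a b u} {v}

  deleteArc-keeps : ∀ {u v} → Arc F u v → ¬ (u ≡ a × v ≡ b) → Arc (deleteArc F a b) u v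
  deleteArc-keeps {u} {v} e ≢ab = ∈-∖⁺ {P = adj F u} {is-pair a b u} {v} e (≢ab ∘ is-pair⁻)

  arcCount-deleteArc : Arc F a b → arcCount (deleteArc F a b) < arcCount F
  arcCount-deleteArc ab =
    sumFin-mono-< n (λ u → count-mono (adj (deleteArc F a b) u) (adj F u) (deleteArc-⊆ u)) a
      (count-mono-< (adj (deleteArc F a b) a) (adj F a) (deleteArc-⊆ a) ab λ kept →
        proj₂ (∈-∖⁻ {P = adj F a} {is-pair a b a} kept) (is-pair-refl {a = a} {b}))

bound : ∀ {n} → Digraph n → ℕ
bound {n} F = 4 ^ arcCount F * (n ∸ 1)

quadruple-≤-4^ : ∀ r {m m′} → m < m′ → 2 * (2 * (4 ^ m * r)) ≤ 4 ^ m′ * r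
quadruple-≤-4^ r {m} {m′} m<m′ = begin
  2 * (2 * (4 ^ m * r)) ≡⟨ *-assoc 2 2 (4 ^ m * r) ⟨
  4 * (4 ^ m * r)       ≡⟨ *-assoc 4 (4 ^ m) r ⟨
  4 ^ suc m * r         ≤⟨ *-monoˡ-≤ r (^-monoʳ-≤ 4 m<m′) ⟩
  4 ^ m′ * r            ∎
  where open ≤-Reasoning

bound-deleteArc : ∀ {n} (F : Digraph n) {a b} → Arc F a b →
                  2 * (2 * bound (deleteArc F a b)) ≤ bound F
bound-deleteArc {n} F ab = quadruple-≤-4^ (n ∸ 1) (arcCount-deleteArc F ab)

module Main {N : ℕ} (D : Digraph N) where

  V : Set
  V = Fin N

  VSet : Set
  VSet = V → Bool

  arcPath : ∀ {s t} → s ≢ t → Arc D s t → Path D s t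
  arcPath {s} {t} s≢t e = record
    { ℓ     = 0
    ; p     = s ∷ t ∷ []
    ; inj   = ∷-injective (∷-injective (λ { {()} }) λ ()) λ { zero → s≢t ∘ sym ; (suc ()) }
    ; start = refl
    ; end   = refl
    ; step  = λ { zero → e }
    }

  prependArc : ∀ {u b t} → Arc D u b → (P : Path D b t) → (∀ i → p P i ≢ u) → Path D u t
  prependArc {u} e P u∉P = record
    { ℓ     = suc (ℓ P)
    ; p     = u ∷ p P
    ; inj   = ∷-injective (inj P) u∉P
    ; start = refl
    ; end   = end P
    ; step  = λ { zero → subst (Arc D u) (sym (start P)) e ; (suc i) → step P i }
    }

  simpleWalk⇒path : ∀ {s t} (w : Star (Arc D) s t) → Simple w → s ≢ t →
                    Σ (Path D s t) λ P → ∀ i → p P i ∈ʷ w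
  simpleWalk⇒path ε _ s≢s = ⊥-elim (s≢s refl)
  simpleWalk⇒path (e ◅ ε) _ s≢t = arcPath s≢t e , λ { zero → inj₁ refl ; (suc zero) → inj₂ refl }
  simpleWalk⇒path (e ◅ w@(_ ◅ w′)) (s∉w , simple@(b∉w′ , _)) _
    with simpleWalk⇒path w simple (λ b≡t → b∉w′ (subst (_∈ʷ w′) (sym b≡t) (∈ʷ-end w′)))
  ... | P , P⊆w = prependArc e P (λ i pᵢ≡s → s∉w (subst (_∈ʷ w) pᵢ≡s (P⊆w i)))
                , λ { zero → inj₁ refl ; (suc i) → inj₂ (P⊆w i) }

  walk⇒path : ∀ {s t} → s ≢ t → (w : Star (Arc D) s t) →
              Σ (Path D s t) λ P → ∀ {z} → Internal P z → z ∈ʷ w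
  walk⇒path s≢t w with shortcut _≟_ w
  ... | w′ , simple , w′⊆w with simpleWalk⇒path w′ simple s≢t
  ...   | P , P⊆w′ = P , λ { (i , _ , _ , refl) → w′⊆w (P⊆w′ i) }

  Internal⇒≢ : ∀ {s t} (P : Path D s t) {z} → Internal P z → z ≢ s × z ≢ t
  Internal⇒≢ P (i , 0<i , i<ℓ , refl) =
      (λ pᵢ≡s → <-irrefl (sym (cong toℕ (inj P (trans pᵢ≡s (sym (start P)))))) 0<i)
    , (λ pᵢ≡t → <-irrefl (trans (cong toℕ (inj P (trans pᵢ≡t (sym (end P))))) (toℕ-fromℕ _))
                          i<ℓ)

  cycleWithin : ∀ {S S′ : V → Set} (C : CycleIn D S) → (∀ j → S′ (CycleIn.c C j)) → CycleIn D S′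
  cycleWithin C inS′ = record
    { k = CycleIn.k C ; c = CycleIn.c C ; inj = CycleIn.inj C ; inS = inS′
    ; step = CycleIn.step C ; close = CycleIn.close C }

  cycle-not-single : ∀ {S} (C : CycleIn D S) {w} → ¬ (∀ j → CycleIn.c C j ≡ w)
  cycle-not-single record { k = zero ; close = close } same =
    Arc-irreflexive D (subst₂ (Arc D) (same zero) (same zero) close)
  cycle-not-single record { k = suc _ ; inj = inj } same
    with inj (trans (same zero) (sym (same (suc zero))))
  ... | ()

  cycle-constant : ∀ {A : Set} {_≲_ : A → A → Set} → IsPartialOrder _≡_ _≲_ →
                   ∀ {S} (g : V → A) (C : CycleIn D S) →
                   (∀ {u v} → S u → S v → Arc D u v → g u ≲ g v) →
                   ∀ j → g (CycleIn.c C j) ≡ g (CycleIn.c C zero)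
  cycle-constant po g C mono = around-cycle-constant po (g ∘ c)
      (λ i → mono (inS (inject₁ i)) (inS (suc i)) (CycleIn.step C i))
      (mono (inS (fromℕ k)) (inS zero) close)
    where open CycleIn C using (k; c; inS; close)

  -- Dicolourings of vertex sets

  ColourClass : ∀ (U : VSet) {k} → (∀ v → v ∈ U → Fin k) → Fin k → V → Set
  ColourClass U colour i v = Σ (v ∈ U) λ h → colour v h ≡ i

  record Dicolouring (U : VSet) (k : ℕ) : Set where
    field
      colour  : ∀ v → v ∈ U → Fin k
      acyclic : ∀ i → ¬ CycleIn D (ColourClass U colour i)

  open Dicolouring

  Dicolouring⇒Dicolourable : ∀ {k} → Dicolouring (λ _ → true) k → Dicolourable D k
  Dicolouring⇒Dicolourable χ =
      (λ v → colour χ v tt)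
    , λ i C → acyclic χ i (cycleWithin C λ j → tt , CycleIn.inS C j)

  Dicolouring-≤ : ∀ {U k k′} → k ≤ k′ → Dicolouring U k → Dicolouring U k′
  Dicolouring-≤ k≤k′ χ = record
    { colour  = λ v h → inject≤ (colour χ v h) k≤k′
    ; acyclic = λ i C → let open CycleIn C using (c; inS) in
        acyclic χ (colour χ (c zero) (proj₁ (inS zero))) (cycleWithin C λ j →
            proj₁ (inS j)
          , inject≤-injective k≤k′ k≤k′ _ _ (trans (proj₂ (inS j)) (sym (proj₂ (inS zero)))))
    }

  emptyDicolouring : ∀ {U k} → (∀ v → v ∉ U) → Dicolouring U k
  emptyDicolouring empty = record
    { colour  = λ v v∈U → ⊥-elim (empty v v∈U)
    ; acyclic = λ i C → empty _ (proj₁ (CycleIn.inS C zero))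
    }

  -- Colour each vertex by one of its preimages: every colour class is a single vertex.
  coveredDicolouring : ∀ {m U} (φ : Fin m → V) → (∀ {v} → v ∈ U → ∃ λ i → φ i ≡ v) →
                       Dicolouring U m
  coveredDicolouring φ covered = record
    { colour  = λ v v∈U → proj₁ (covered v∈U)
    ; acyclic = λ i C → let open CycleIn C using (c; inS) in
        cycle-not-single C λ j →
          trans (sym (proj₂ (covered (proj₁ (inS j))))) (cong φ (proj₂ (inS j)))
    }

  glue : ∀ {U P k} → (∀ (C : CycleIn D (_∈ U)) j → P (CycleIn.c C j) ≡ P (CycleIn.c C zero)) →
         Dicolouring P k → Dicolouring (U ∖ P) k → Dicolouring U k
  glue {U} {P} {k} P-on-cycles χ χ′ = record { colour = colour′ ; acyclic = acyclic′ }
    where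
      pick : ∀ {v} → v ∈ U → Dec (v ∈ P) → Fin k
      pick     _   (yes v∈P) = colour χ _ v∈P
      pick {v} v∈U (no  v∉P) = colour χ′ _ (∈-∖⁺ {P = U} {P} {v} v∈U v∉P)

      colour′ : ∀ v → v ∈ U → Fin k
      colour′ v v∈U = pick v∈U (T? (P v))

      pick-∈ : ∀ {v} (v∈U : v ∈ U) d (v∈P : v ∈ P) → pick v∈U d ≡ colour χ v v∈P
      pick-∈ _ (yes v∈P′) v∈P = cong (colour χ _) (Bool.T-irrelevant v∈P′ v∈P)
      pick-∈ _ (no  v∉P)  v∈P = ⊥-elim (v∉P v∈P)

      pick-∉ : ∀ {v} (v∈U : v ∈ U) d (v∈U∖P : v ∈ U ∖ P) → pick v∈U d ≡ colour χ′ v v∈U∖P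
      pick-∉ _ (yes v∈P) v∈U∖P = ⊥-elim (proj₂ (∈-∖⁻ {P = U} {P} v∈U∖P) v∈P)
      pick-∉ _ (no  v∉P) v∈U∖P = cong (colour χ′ _) (Bool.T-irrelevant _ v∈U∖P)

      acyclic′ : ∀ i → ¬ CycleIn D (ColourClass U colour′ i)
      acyclic′ i C = split (T? (P (c zero)))
        where
          open CycleIn C using (c; inS)
          same : ∀ j → P (c j) ≡ P (c zero)
          same = P-on-cycles (cycleWithin C (proj₁ ∘ inS))
          split : Dec (c zero ∈ P) → ⊥
          split (yes c₀∈P) = acyclic χ i (cycleWithin C λ j →
            let v∈P = subst T (sym (same j)) c₀∈P
            in v∈P , trans (sym (pick-∈ (proj₁ (inS j)) (T? (P (c j))) v∈P)) (proj₂ (inS j)))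
          split (no c₀∉P) = acyclic χ′ i (cycleWithin C λ j →
            let v∈U∖P = ∈-∖⁺ {P = U} {P} (proj₁ (inS j)) (c₀∉P ∘ subst T (same j))
            in v∈U∖P , trans (sym (pick-∉ (proj₁ (inS j)) (T? (P (c j))) v∈U∖P)) (proj₂ (inS j)))

  -- Colour v by the parity of d v together with its colour inside its level.  A monochromatic
  -- cycle then has d monotone along its arcs, hence constant, so it lies in a single level.
  levelColouring : ∀ {R k} {_≲_ : ℕ → ℕ → Set} (d : V → ℕ) → IsPartialOrder _≡_ _≲_ →
    (∀ {u v} → u ∈ R → v ∈ R → Arc D u v → parity (d u) ≡ parity (d v) → d u ≲ d v) →
    (∀ i → Dicolouring (level R d i) k) → Dicolouring R (2 * k)
  levelColouring {R} {k} d po mono χ = record { colour = colour′ ; acyclic = acyclic′ }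
    where
      colour′ : ∀ v → v ∈ R → Fin (2 * k)
      colour′ v v∈R = combine (parity (d v)) (colour (χ (d v)) v (∈-level⁺ {P = R} {d} v∈R refl))

      colour-cong : ∀ {i i′ v} → i ≡ i′ → (h : v ∈ level R d i) (h′ : v ∈ level R d i′) →
                    colour (χ i) v h ≡ colour (χ i′) v h′
      colour-cong refl h h′ = cong (colour (χ _) _) (Bool.T-irrelevant h h′)

      acyclic′ : ∀ κ → ¬ CycleIn D (ColourClass R colour′ κ)
      acyclic′ κ C = acyclic (χ i₀) κ₀ (cycleWithin C onLevel)
        where
          open CycleIn C using (c; inS)
          i₀ = d (c zero)
          κ₀ = colour (χ i₀) (c zero) (∈-level⁺ {P = R} {d} (proj₁ (inS zero)) refl)

          same-colour : ∀ j → colour′ (c j) (proj₁ (inS j)) ≡ colour′ (c zero) (proj₁ (inS zero))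
          same-colour j = trans (proj₂ (inS j)) (sym (proj₂ (inS zero)))

          level≡ : ∀ j → d (c j) ≡ i₀
          level≡ = cycle-constant po d C λ (u∈R , κu) (v∈R , κv) e →
            mono u∈R v∈R e (combine-injectiveˡ (parity (d _)) _ (parity (d _)) _ (trans κu (sym κv)))

          onLevel : ∀ j → ColourClass (level R d i₀) (colour (χ i₀)) κ₀ (c j)
          onLevel j = let h = ∈-level⁺ {P = R} {d} (proj₁ (inS j)) (level≡ j) in
            h , trans (sym (colour-cong (level≡ j) _ h))
                      (combine-injectiveʳ (parity (d (c j))) _ (parity i₀) κ₀ (same-colour j))

  -- Subdivisions inside vertex sets

  record SubdivisionWithin {nF} (F : Digraph nF) (U : VSet) : Set where
    field
      subdivision : ContainsSubdivision D F
      branch∈     : ∀ x → ContainsSubdivision.φ subdivision x ∈ U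
      internal∈   : ∀ u v (e : Arc F u v) {w} →
                    Internal (ContainsSubdivision.path subdivision u v e) w → w ∈ U

  SubdivisionWithin-mono : ∀ {nF} {F : Digraph nF} {U U′} → U ⊆ U′ →
                           SubdivisionWithin F U → SubdivisionWithin F U′
  SubdivisionWithin-mono U⊆U′ sub = record
    { subdivision = subdivision
    ; branch∈     = U⊆U′ ∘ branch∈
    ; internal∈   = λ u v e → U⊆U′ ∘ internal∈ u v e
    }
    where open SubdivisionWithin sub

  -- The old paths have their interiors inside S and the new one outside S, so all stay disjoint.
  extend : ∀ {nF} {F : Digraph nF} {a b} {S U : VSet} → S ⊆ U →
           (sub : SubdivisionWithin (deleteArc F a b) S) →
           let open ContainsSubdivision (SubdivisionWithin.subdivision sub) in
           (P : Path D (φ a) (φ b)) → (∀ {w} → Internal P w → w ∈ U ∖ S) →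
           SubdivisionWithin F U
  extend {F = F} {a} {b} {S} {U} S⊆U sub P P∖S = record
    { subdivision = record
        { φ = φ ; φ-inj = φ-inj ; path = path′ ; avoid = avoid′ ; disjoint = disjoint′ }
    ; branch∈   = S⊆U ∘ branch∈
    ; internal∈ = internal∈′
    }
    where
      open SubdivisionWithin sub
      open ContainsSubdivision subdivision

      route : ∀ u v → Arc F u v → Dec (u ≡ a × v ≡ b) → Path D (φ u) (φ v)
      route _ _ _ (yes (refl , refl)) = P
      route u v e (no ≢ab)            = path u v (deleteArc-keeps F e ≢ab)

      path′ : ∀ u v → Arc F u v → Path D (φ u) (φ v)
      path′ u v e = route u v e ((u ≟ a) ×-dec (v ≟ b))

      internal-route : ∀ u v e d {w} → Internal (route u v e d) w →
                       (w ∈ U ∖ S × u ≡ a × v ≡ b) ⊎ (∃ λ e′ → Internal (path u v e′) w)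
      internal-route _ _ _ (yes (refl , refl)) i = inj₁ (P∖S i , refl , refl)
      internal-route _ _ _ (no _)              i = inj₂ (_ , i)

      internal-path′ : ∀ u v e {w} → Internal (path′ u v e) w →
                       (w ∈ U ∖ S × u ≡ a × v ≡ b) ⊎ (∃ λ e′ → Internal (path u v e′) w)
      internal-path′ u v e = internal-route u v e ((u ≟ a) ×-dec (v ≟ b))

      ∉S : ∀ {w} → w ∈ U ∖ S → w ∉ S
      ∉S = proj₂ ∘ ∈-∖⁻ {P = U} {S}

      avoid′ : ∀ u v e w → Internal (path′ u v e) w → ∀ x → φ x ≢ w
      avoid′ u v e w i x φx≡w with internal-path′ u v e i
      ... | inj₁ (w∈U∖S , _) = ∉S w∈U∖S (subst (_∈ S) φx≡w (branch∈ x))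
      ... | inj₂ (e′ , i′)   = avoid u v e′ w i′ x φx≡w

      disjoint′ : ∀ u v e u′ v′ e′ → ¬ (u ≡ u′ × v ≡ v′) →
                  ∀ w → Internal (path′ u v e) w → ¬ Internal (path′ u′ v′ e′) w
      disjoint′ u v e u′ v′ e′ distinct w i i′
        with internal-path′ u v e i | internal-path′ u′ v′ e′ i′
      ... | inj₁ (_ , refl , refl) | inj₁ (_ , refl , refl) = distinct (refl , refl)
      ... | inj₁ (w∈U∖S , _)       | inj₂ (e″ , i″)         = ∉S w∈U∖S (internal∈ u′ v′ e″ i″)
      ... | inj₂ (e″ , i″)         | inj₁ (w∈U∖S , _)       = ∉S w∈U∖S (internal∈ u v e″ i″)
      ... | inj₂ (e₁ , i₁)         | inj₂ (e₂ , i₂)         = disjoint u v e₁ u′ v′ e₂ distinct w i₁ i₂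

      internal∈′ : ∀ u v e {w} → Internal (path′ u v e) w → w ∈ U
      internal∈′ u v e i with internal-path′ u v e i
      ... | inj₁ (w∈U∖S , _) = proj₁ (∈-∖⁻ {P = U} {S} w∈U∖S)
      ... | inj₂ (e′ , i′)   = S⊆U (internal∈ u v e′ i′)

  injection⊎dicolouring : ∀ m (U : VSet) →
    (Σ (Fin m → V) λ φ → Injective _≡_ _≡_ φ × (∀ i → φ i ∈ U)) ⊎ Dicolouring U (m ∸ 1)
  injection⊎dicolouring zero    U = inj₁ ([] , (λ { {()} }) , λ ())
  injection⊎dicolouring (suc m) U with injection⊎dicolouring m U
  ... | inj₂ χ = inj₂ (Dicolouring-≤ (m∸n≤m m 1) χ)
  ... | inj₁ (φ , φ-inj , φ∈U) with ∃-or-∀ outside-or-covered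
    where
      outside-or-covered : ∀ v → (v ∈ U × ∀ i → φ i ≢ v) ⊎ (v ∈ U → ∃ λ i → φ i ≡ v)
      outside-or-covered v with ∃-or-∀ (λ i → toSum (φ i ≟ v)) | T? (U v)
      ... | inj₁ hit  | _         = inj₂ λ _ → hit
      ... | inj₂ miss | yes v∈U   = inj₁ (v∈U , miss)
      ... | inj₂ _    | no  v∉U   = inj₂ λ v∈U → ⊥-elim (v∉U v∈U)
  ...   | inj₁ (v , v∈U , v∉φ) =
    inj₁ (v ∷ φ , ∷-injective φ-inj v∉φ , λ { zero → v∈U ; (suc i) → φ∈U i })
  ...   | inj₂ covered         = inj₂ (coveredDicolouring φ λ {v} → covered v)

  module Reach (U : VSet) (x : V) (x∈U : x ∈ U) (E : V → V → Bool) where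

    successors : VSet → VSet
    successors L v = ⌊ any? (λ u → T? (L u) ×-dec T? (E u v)) ⌋

    grow : VSet → VSet
    grow L = L ∪ U ∩ successors L

    grow-intro : ∀ {L u v} → u ∈ L → T (E u v) → v ∈ U → v ∈ grow L
    grow-intro {L} {u} {v} u∈L e v∈U =
      ∈-∪⁺ʳ {P = L} {U ∩ successors L} {v}
        (∈-∩⁺ {P = U} {successors L} v∈U (fromWitness (u , u∈L , e)))

    grow-⊇ : ∀ {L} → L ⊆ grow L
    grow-⊇ {L} {v} = ∈-∪⁺ˡ {P = L} {U ∩ successors L} {v}

    grow-elim : ∀ {L v} → v ∈ grow L → v ∈ L ⊎ (v ∈ U × ∃ λ u → u ∈ L × T (E u v))
    grow-elim {L} {v} h with ∈-∪⁻ {P = L} {U ∩ successors L} {v} h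
    ... | inj₁ v∈L = inj₁ v∈L
    ... | inj₂ h′  = let v∈U , new = ∈-∩⁻ {P = U} {successors L} h′ in inj₂ (v∈U , toWitness new)

    grow-mono : ∀ {L L′} → L ⊆ L′ → grow L ⊆ grow L′
    grow-mono {L} {L′} L⊆L′ {v} h with grow-elim {L} h
    ... | inj₁ v∈L                 = grow-⊇ {L′} (L⊆L′ v∈L)
    ... | inj₂ (v∈U , _ , u∈L , e) = grow-intro (L⊆L′ u∈L) e v∈U

    layer : ℕ → VSet
    layer zero    v = ⌊ v ≟ x ⌋
    layer (suc t)   = grow (layer t)

    reached : VSet
    reached = layer N

    layer-⊆U : ∀ t → layer t ⊆ U
    layer-⊆U zero    h = subst (_∈ U) (sym (toWitness h)) x∈U
    layer-⊆U (suc t) h with grow-elim {layer t} h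
    ... | inj₁ h′        = layer-⊆U t h′
    ... | inj₂ (v∈U , _) = v∈U

    layer-mono : ∀ {s t} → s ≤ t → layer s ⊆ layer t
    layer-mono = mono′ ∘ ≤⇒≤′
      where
        mono′ : ∀ {s t} → s ≤′ t → layer s ⊆ layer t
        mono′ ≤′-refl          h = h
        mono′ (≤′-step s≤′t) h = grow-⊇ (mono′ s≤′t h)

    layer-⊆-reached : ∀ t → layer t ⊆ reached
    layer-⊆-reached t with chain-stabilises layer (λ t → grow-⊇ {layer t})
    ... | t₀ , t₀≤N , stable = layer-mono t₀≤N ∘ below t
      where
        below : ∀ t → layer t ⊆ layer t₀
        below zero    = layer-mono {t = t₀} z≤n
        below (suc t) = stable ∘ grow-mono (below t)

    x∈reached : x ∈ reached
    x∈reached = layer-mono {t = N} z≤n (fromWitness {a? = x ≟ x} refl)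

    reached-closed : ∀ {u v} → u ∈ reached → T (E u v) → v ∈ U → v ∈ reached
    reached-closed u∈ e v∈U = layer-⊆-reached (suc N) (grow-intro u∈ e v∈U)

    firstLayer : ℕ → V → ℕ
    firstLayer zero    v = zero
    firstLayer (suc t) v = if layer t v then firstLayer t v else suc t

    firstLayer-old : ∀ t {v} → v ∈ layer t → firstLayer (suc t) v ≡ firstLayer t v
    firstLayer-old t {v} v∈ with layer t v
    ... | true = refl

    firstLayer-new : ∀ t {v} → v ∉ layer t → firstLayer (suc t) v ≡ suc t
    firstLayer-new t {v} v∉ with layer t v
    ... | true  = ⊥-elim (v∉ tt)
    ... | false = refl

    firstLayer-∈ : ∀ t {v} → v ∈ layer t → v ∈ layer (firstLayer t v)
    firstLayer-∈ zero    h = h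
    firstLayer-∈ (suc t) {v} h with T? (layer t v)
    ... | yes old = subst (λ s → v ∈ layer s) (sym (firstLayer-old t old)) (firstLayer-∈ t old)
    ... | no  new = subst (λ s → v ∈ layer s) (sym (firstLayer-new t new)) h

    firstLayer-min : ∀ t {s v} → v ∈ layer t → v ∈ layer s → firstLayer t v ≤ s
    firstLayer-min zero    _ _ = z≤n
    firstLayer-min (suc t) {s} {v} h h′ with T? (layer t v)
    ... | yes old = subst (_≤ s) (sym (firstLayer-old t old)) (firstLayer-min t old h′)
    ... | no  new = subst (_≤ s) (sym (firstLayer-new t new))
                      (≮⇒≥ λ s<1+t → new (layer-mono (≤-pred s<1+t) h′))

    -- The distance from x; it is meaningless (equal to N) outside reached.
    dist : V → ℕ
    dist = firstLayer N

    dist-∈ : ∀ {v} → v ∈ reached → v ∈ layer (dist v)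
    dist-∈ = firstLayer-∈ N

    dist-min : ∀ {t v} → v ∈ layer t → dist v ≤ t
    dist-min {t} h = firstLayer-min N (layer-⊆-reached t h) h

    dist-arc : ∀ {u v} → u ∈ reached → T (E u v) → v ∈ U → dist v ≤ suc (dist u)
    dist-arc u∈ e v∈U = dist-min (grow-intro (dist-∈ u∈) e v∈U)

    walkBack : ∀ t {v} → v ∈ layer t →
      Σ (Star (λ a b → T (E b a)) v x) λ w → ∀ {z} → z ∈ʷ w → z ∈ U × (z ≡ v ⊎ dist z < t)
    walkBack zero h with refl ← toWitness h = ε , λ { refl → x∈U , inj₁ refl }
    walkBack (suc t) h with grow-elim {layer t} h
    ... | inj₁ h′ with walkBack t h′
    ...   | w , ok = w , Product.map₂ (Sum.map₂ m<n⇒m<1+n) ∘ ok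
    walkBack (suc t) h | inj₂ (v∈U , u , u∈L , e) with walkBack t u∈L
    ...   | w , ok = e ◅ w , λ { (inj₁ refl) → v∈U , inj₁ refl ; (inj₂ z∈w) → closer (ok z∈w) }
      where
        closer : ∀ {z} → z ∈ U × (z ≡ u ⊎ dist z < t) → z ∈ U × (_ ⊎ dist z < suc t)
        closer (z∈U , inj₁ refl) = z∈U , inj₂ (s≤s (dist-min u∈L))
        closer (z∈U , inj₂ lt)   = z∈U , inj₂ (m<n⇒m<1+n lt)

  -- R is the strong component of x in D[U]; dO and dI are the distances from and to x.
  module Around (U : VSet) (x : V) (x∈U : x ∈ U) where
    module Out = Reach U x x∈U (adj D)
    module In  = Reach U x x∈U (flip (adj D))

    dO dI : V → ℕ
    dO = Out.dist
    dI = In.dist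

    R : VSet
    R = Out.reached ∩ In.reached

    R⊆Out : R ⊆ Out.reached
    R⊆Out = proj₁ ∘ ∈-∩⁻ {P = Out.reached} {In.reached}

    R⊆In : R ⊆ In.reached
    R⊆In = proj₂ ∘ ∈-∩⁻ {P = Out.reached} {In.reached}

    R⊆U : R ⊆ U
    R⊆U = Out.layer-⊆U N ∘ R⊆Out

    x∈R : x ∈ R
    x∈R = ∈-∩⁺ {P = Out.reached} {In.reached} Out.x∈reached In.x∈reached

    R-on-cycles : ∀ (C : CycleIn D (_∈ U)) j → R (CycleIn.c C j) ≡ R (CycleIn.c C zero)
    R-on-cycles C j = cong₂ _∧_
      (cycle-constant Bool.≤-isPartialOrder Out.reached C
        (λ _ v∈U e → ≤ᵇ-from-T λ u∈ → Out.reached-closed u∈ e v∈U) j)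
      (cycle-constant (PosetProperties.≥-isPartialOrder Bool.≤-poset) In.reached C
        (λ u∈U _ e → ≤ᵇ-from-T λ v∈ → In.reached-closed v∈ e u∈U) j)

    dO-monotone : ∀ {u v} → u ∈ R → v ∈ R → Arc D u v → parity (dO u) ≡ parity (dO v) → dO v ≤ dO u
    dO-monotone u∈R v∈R e same = same-parity-≤ (Out.dist-arc (R⊆Out u∈R) e (R⊆U v∈R)) (sym same)

    dI-monotone : ∀ {u v} → u ∈ R → v ∈ R → Arc D u v → parity (dI u) ≡ parity (dI v) → dI u ≤ dI v
    dI-monotone u∈R v∈R e same = same-parity-≤ (In.dist-arc (R⊆In v∈R) e (R⊆U u∈R)) same

    -- Go from u back to x through closer in-layers, then forward to w through closer out-layers.
    throughX : ∀ {u w} → u ∈ R → w ∈ R → u ≢ w →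
               Σ (Path D u w) λ P → ∀ {z} → Internal P z → z ∈ U × (dI z < dI u ⊎ dO z < dO w)
    throughX {u} {w} u∈R w∈R u≢w = P , internal
      where
        toX   = In.walkBack (dI u) (In.dist-∈ (R⊆In u∈R))
        fromX = Out.walkBack (dO w) (Out.dist-∈ (R⊆Out w∈R))
        walk  = proj₁ toX ◅◅ reverse (λ e → e) (proj₁ fromX)
        P     = proj₁ (walk⇒path u≢w walk)

        internal : ∀ {z} → Internal P z → z ∈ U × (dI z < dI u ⊎ dO z < dO w)
        internal iz with Internal⇒≢ P iz | ∈ʷ-◅◅ (proj₁ toX) _ (proj₂ (walk⇒path u≢w walk) iz)
        ... | z≢u , _   | inj₁ z∈ with proj₂ toX z∈
        ...   | z∈U , inj₁ z≡u = ⊥-elim (z≢u z≡u)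
        ...   | z∈U , inj₂ lt  = z∈U , inj₁ lt
        internal iz | _ , z≢w | inj₂ z∈ with proj₂ fromX (∈ʷ-reverse (proj₁ fromX) z∈)
        ...   | z∈U , inj₁ z≡w = ⊥-elim (z≢w z≡w)
        ...   | z∈U , inj₂ lt  = z∈U , inj₂ lt

  -- The induction on arcs and vertices

  Dichotomy : ∀ {nF} → Digraph nF → VSet → Set
  Dichotomy F U = SubdivisionWithin F U ⊎ Dicolouring U (bound F)

  arcless-dichotomy : ∀ {nF} (F : Digraph nF) → (∀ a b → ¬ Arc F a b) → ∀ U → Dichotomy F U
  arcless-dichotomy {nF} F arcless U with injection⊎dicolouring nF U
  ... | inj₁ (φ , φ-inj , φ∈U) = inj₁ record
      { subdivision = record
          { φ = φ ; φ-inj = φ-inj ; path = noArc ; avoid = noArc ; disjoint = noArc }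
      ; branch∈     = φ∈U
      ; internal∈   = noArc
      }
    where
      noArc : ∀ {A : ∀ u v → Arc F u v → Set} u v (e : Arc F u v) → A u v e
      noArc u v e = ⊥-elim (arcless u v e)
  ... | inj₂ χ =
    inj₂ (Dicolouring-≤ (m≤n*m (nF ∸ 1) (4 ^ arcCount F) {{m^n≢0 4 (arcCount F)}}) χ)

  module Step {nF} (F : Digraph nF) (a b : Fin nF) (ab : Arc F a b)
              (IH : ∀ S → Dichotomy (deleteArc F a b) S) where

    module AtVertex (U : VSet) (x : V) (x∈U : x ∈ U) where
      open Around U x x∈U

      class : ℕ → ℕ → VSet
      class i j = level (level R dO i) dI j

      ∈class⁻ : ∀ {i j v} → v ∈ class i j → v ∈ R × dO v ≡ i × dI v ≡ j
      ∈class⁻ {i} {j} h =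
        let v∈Rᵢ , dI≡ = ∈-level⁻ {P = level R dO i} {dI} {j} h
            v∈R , dO≡ = ∈-level⁻ {P = R} {dO} {i} v∈Rᵢ
        in v∈R , dO≡ , dI≡

      smaller : count (U ∖ R) < count U
      smaller = count-mono-< (U ∖ R) U (proj₁ ∘ ∈-∖⁻ {P = U} {R}) x∈U
                  λ x∈U∖R → proj₂ (∈-∖⁻ {P = U} {R} x∈U∖R) x∈R

      extendThroughX : ∀ {i j} → SubdivisionWithin (deleteArc F a b) (class i j) →
                       SubdivisionWithin F U
      extendThroughX {i} {j} sub = extend (R⊆U ∘ proj₁ ∘ ∈class⁻) sub P outside
        where
          open SubdivisionWithin sub
          open ContainsSubdivision subdivision using (φ; φ-inj)

          φa∈ = ∈class⁻ (branch∈ a)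
          φb∈ = ∈class⁻ (branch∈ b)

          φa≢φb : φ a ≢ φ b
          φa≢φb φa≡φb = Arc-irreflexive F (subst (Arc F a) (sym (φ-inj φa≡φb)) ab)

          route = throughX (proj₁ φa∈) (proj₁ φb∈) φa≢φb
          P     = proj₁ route

          outside : ∀ {w} → Internal P w → w ∈ U ∖ class i j
          outside iw with proj₂ route iw
          ... | w∈U , inj₁ dI< = ∈-∖⁺ {P = U} {class i j} w∈U λ w∈ →
                  <-irrefl (trans (proj₂ (proj₂ (∈class⁻ w∈))) (sym (proj₂ (proj₂ φa∈)))) dI<
          ... | w∈U , inj₂ dO< = ∈-∖⁺ {P = U} {class i j} w∈U λ w∈ →
                  <-irrefl (trans (proj₁ (proj₂ (∈class⁻ w∈))) (sym (proj₁ (proj₂ φb∈)))) dO<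

      -- A class that contains no vertex is coloured vacuously.
      allClasses : ∀ {k} → (∀ v → Dicolouring (class (dO v) (dI v)) k) →
                   ∀ i j → Dicolouring (class i j) k
      allClasses {k} χ i j with ∃-or-∀ (λ v → toSum (T? (class i j v)))
      ... | inj₁ (v , v∈) = let _ , dO≡ , dI≡ = ∈class⁻ v∈ in
                            subst₂ (λ i j → Dicolouring (class i j) k) dO≡ dI≡ (χ v)
      ... | inj₂ empty    = emptyDicolouring empty

      colourR : (∀ v → Dicolouring (class (dO v) (dI v)) (bound (deleteArc F a b))) →
                Dicolouring R (bound F)
      colourR χ = Dicolouring-≤ (bound-deleteArc F ab)
        (levelColouring dO (PosetProperties.≥-isPartialOrder ≤-poset) dO-monotone λ i →
          levelColouring dI ≤-isPartialOrder
            (λ u∈ v∈ → dI-monotone (proj₁ (∈-level⁻ {P = R} {dO} u∈))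
                                   (proj₁ (∈-level⁻ {P = R} {dO} v∈)))
            (allClasses χ i))

      dichotomy-at : Dichotomy F (U ∖ R) → Dichotomy F U
      dichotomy-at (inj₁ sub) = inj₁ (SubdivisionWithin-mono (proj₁ ∘ ∈-∖⁻ {P = U} {R}) sub)
      dichotomy-at (inj₂ χ) with ∃-or-∀ (λ v → IH (class (dO v) (dI v)))
      ... | inj₁ (_ , sub) = inj₁ (extendThroughX sub)
      ... | inj₂ χs        = inj₂ (glue R-on-cycles (colourR χs) χ)

    dichotomy : ∀ U → Dichotomy F U
    dichotomy U = go U (On.wellFounded count <-wellFounded U)
      where
        go : ∀ U → Acc (_<_ on count) U → Dichotomy F U
        go U (acc smaller) with ∃-or-∀ (λ v → toSum (T? (U v)))
        ... | inj₂ empty     = inj₂ (emptyDicolouring empty)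
        ... | inj₁ (x , x∈U) = AtVertex.dichotomy-at U x x∈U
                                 (go _ (smaller (AtVertex.smaller U x x∈U)))

  dichotomy : ∀ {nF} (F : Digraph nF) U → Dichotomy F U
  dichotomy {nF} F = go F (On.wellFounded arcCount <-wellFounded F)
    where
      go : ∀ (F : Digraph nF) → Acc (_<_ on arcCount) F → ∀ U → Dichotomy F U
      go F (acc smaller) U with ∃-or-∀ (λ a → ∃-or-∀ (λ b → toSum (T? (adj F a b))))
      ... | inj₂ arcless      = arcless-dichotomy F arcless U
      ... | inj₁ (a , b , ab) =
        Step.dichotomy F a b ab (go _ (smaller (arcCount-deleteArc F ab))) U

theorem32 : ∀ {nF : ℕ} (F : Digraph nF) {nD : ℕ} (D : Digraph nD) →
    DichromaticAtLeast D (4 ^ arcCount F * (nF ∸ 1) + 1) →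
    ContainsSubdivision D F
theorem32 F D χ≥ with Main.dichotomy D F (λ _ → true)
... | inj₁ sub = Main.SubdivisionWithin.subdivision sub
... | inj₂ χ   =
  ⊥-elim (χ≥ (bound F) (m<m+n (bound F) (s≤s z≤n)) (Main.Dicolouring⇒Dicolourable D χ))
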